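{- Let $X$ be a set, let $M$ be a subalgebra of $\mathbb{3}^{X}$, and let $\alpha_i\in M$ for $1\leq i\leq N$ be represented by the pairs of sets $(A_i,B_i)$ respectively. Then $\bigoplus_{i=1}^{N}\alpha_i$ exists if and only if $A_i\cap(A_j\cup B_j)^{c}=\emptyset$ for all $i,j\in\{1,\dots,N\}$.
   Context: $\mathbb{3}$ denotes McCarthy's three-valued $C$-algebra on $\{T,F,U\}$ with operations: $\neg T = F$, $\neg F = T$, $\neg U = U$; $T\wedge x = x$, $F \wedge x = F$, $U \wedge x = U$; $T \vee x = T$, $F \vee x = x$, $U \vee x = U$. $\mathbb{3}^{X}$ has pointwise operations. An element $\alpha\in\mathbb{3}^X$ is represented by the pair of disjoint subsets $(\alpha^{ -1}(T),\alpha^{ -1}(F))$ of $X$; complements are taken in $X$. For finitely many elements $a_1,\dots,a_N$: if $a_{\sigma(1)}\vee\cdots\vee a_{\sigma(N)}=a_1\vee\cdots\vee a_N$ for every bijection $\sigma$ of $\{1,\dots,N\}$, then $\bigoplus_{i=1}^N a_i$ is said to exist and equals this value. -}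

module Defs where

open import Level using (Level; suc; _⊔_)
open import Data.Nat using (ℕ)
open import Data.Fin using (Fin)
open import Data.Fin.Permutation using (Permutation′; _⟨$⟩ʳ_)
open import Relation.Binary.PropositionalEquality using (_≡_)
open import Relation.Unary using (Pred)

-- McCarthy's three-valued C-algebra 𝟛 on {T, F, U}
data Three : Set where
  T F U : Three

¬₃_ : Three → Three
¬₃ T = F
¬₃ F = T
¬₃ U = U

_∧₃_ : Three → Three → Three
T ∧₃ x = x
F ∧₃ x = F
U ∧₃ x = U

_∨₃_ : Three → Three → Three
T ∨₃ x = T
F ∨₃ x = x
U ∨₃ x = U

module _ {ℓ : Level} (X : Set ℓ) where

  3^ : Set ℓ
  3^ = X → Three

module _ {ℓ : Level} {X : Set ℓ} where

  ¬ₚ_ : 3^ X → 3^ X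
  (¬ₚ a) x = ¬₃ (a x)

  _∧ₚ_ : 3^ X → 3^ X → 3^ X
  (a ∧ₚ b) x = a x ∧₃ b x

  _∨ₚ_ : 3^ X → 3^ X → 3^ X
  (a ∨ₚ b) x = a x ∨₃ b x

  -- equality in 𝟛^X (pointwise; no function extensionality in Agda)
  _≐_ : 3^ X → 3^ X → Set ℓ
  a ≐ b = ∀ x → a x ≡ b x

  record IsSubalgebra {m : Level} (M : Pred (3^ X) m) : Set (ℓ ⊔ m) where
    field
      ¬-closed : ∀ {a} → M a → M (¬ₚ a)
      ∧-closed : ∀ {a b} → M a → M b → M (a ∧ₚ b)
      ∨-closed : ∀ {a b} → M a → M b → M (a ∨ₚ b)

  -- representation of α by the pair (α⁻¹(T), α⁻¹(F))
  Tset : 3^ X → Pred X Level.zero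
  Tset α x = α x ≡ T

  Fset : 3^ X → Pred X Level.zero
  Fset α x = α x ≡ F

  ⋁ : ∀ {n} → (Fin (ℕ.suc n) → 3^ X) → 3^ X
  ⋁ {ℕ.zero} a = a Fin.zero
  ⋁ {ℕ.suc n} a = a Fin.zero ∨ₚ ⋁ (λ i → a (Fin.suc i))

  -- ⊕ a exists: the join is invariant under every bijection σ of {1..N}
  ⊕-exists : ∀ {n} → (Fin (ℕ.suc n) → 3^ X) → Set ℓ
  ⊕-exists {n} a = (σ : Permutation′ (ℕ.suc n)) → ⋁ (λ i → a (σ ⟨$⟩ʳ i)) ≐ ⋁ a

module Submission where

-- Everything happens pointwise, at a fixed x ∈ X, on the
-- values w_k = α_k(x) ∈ 𝟛.  The join a_1 ∨ ⋯ ∨ a_N is the first value that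
-- is not F (or F if there is none), so it depends on the ORDER of the terms
-- exactly when a T and a U both occur at some x.
--
--  (⇒) If ⊕ α exists, then moving α_i to the front by a transposition shows
--      that every value α_i(x) ≠ F equals the join (⋁ α)(x); hence T and U
--      never occur together at one point, which is the set condition.
--  (⇐) Under the set condition, at every x all values lie in a two-element
--      set {F, v} that contains a value actually taken (v = T if some α_i(x)
--      is T, otherwise v = U if some is U, otherwise v = F).  The join of a
--      family valued in {F, v} that attains v is v, whatever the order, so
--      every permuted join agrees with ⋁ α.

open import Defs
open import Level using (Level)
open import Data.Nat using (ℕ; suc)
open import Data.Fin using (Fin; zero)
open import Data.Fin.Permutation using (Permutation′; _⟨$⟩ʳ_; _⟨$⟩ˡ_; transpose; inverseʳ)
open import Data.Fin.Properties using (any?)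
open import Data.Product using (_×_; _,_; ∃)
open import Data.Sum using (_⊎_; inj₁; inj₂)
open import Data.Empty using (⊥-elim)
open import Relation.Unary using (Pred; Empty; _∩_; _∪_; ∁)
open import Relation.Nullary using (Dec; yes; no)
open import Relation.Binary.PropositionalEquality using (_≡_; _≢_; refl; sym; trans; subst)
open Relation.Binary.PropositionalEquality.≡-Reasoning

_≟₃_ : (a b : Three) → Dec (a ≡ b)
T ≟₃ T = yes refl
F ≟₃ F = yes refl
U ≟₃ U = yes refl
T ≟₃ F = no λ ()
T ≟₃ U = no λ ()
F ≟₃ T = no λ ()
F ≟₃ U = no λ ()
U ≟₃ T = no λ ()
U ≟₃ F = no λ ()

T≢F : T ≢ F
T≢F ()

T≢U : T ≢ U
T≢U ()

U≢F : U ≢ F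
U≢F ()

Within : Three → Three → Set
Within v w = w ≡ F ⊎ w ≡ v

Within-F : ∀ {w} → Within F w → w ≡ F
Within-F (inj₁ e) = e
Within-F (inj₂ e) = e

∨₃-within : ∀ {v a b} → Within v a → Within v b → Within v (a ∨₃ b)
∨₃-within (inj₁ refl) wb = wb
∨₃-within {T} (inj₂ refl) wb = inj₂ refl
∨₃-within {F} (inj₂ refl) wb = wb
∨₃-within {U} (inj₂ refl) wb = inj₂ refl

∨₃-hit : ∀ {v a b} → Within v a → Within v b → a ≡ v ⊎ b ≡ v → a ∨₃ b ≡ v
∨₃-hit (inj₁ refl) wb (inj₁ refl) = Within-F wb
∨₃-hit (inj₁ refl) wb (inj₂ e) = e
∨₃-hit {T} (inj₂ refl) wb _ = refl
∨₃-hit {F} (inj₂ refl) wb (inj₁ _) = Within-F wb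
∨₃-hit {F} (inj₂ refl) wb (inj₂ e) = e
∨₃-hit {U} (inj₂ refl) wb _ = refl

module _ {ℓ : Level} {X : Set ℓ} (x : X) where

  ⋁-within : ∀ {n v} (a : Fin (suc n) → 3^ X) →
             (∀ k → Within v (a k x)) → Within v (⋁ a x)
  ⋁-within {ℕ.zero} a w = w zero
  ⋁-within {ℕ.suc n} a w = ∨₃-within (w zero) (⋁-within (λ k → a (Fin.suc k)) (λ k → w (Fin.suc k)))

  ⋁-hit : ∀ {n v} (a : Fin (suc n) → 3^ X) →
          (∀ k → Within v (a k x)) → ∃ (λ k → a k x ≡ v) → ⋁ a x ≡ v
  ⋁-hit {ℕ.zero} a w (zero , e) = e
  ⋁-hit {ℕ.suc n} a w (k , e) = ∨₃-hit (w zero) (⋁-within tail (λ k → w (Fin.suc k))) (hit k e)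
    where
      tail : Fin (suc n) → 3^ X
      tail k = a (Fin.suc k)

      hit : ∀ k → a k x ≡ _ → a zero x ≡ _ ⊎ ⋁ tail x ≡ _
      hit zero e = inj₁ e
      hit (Fin.suc k) e = inj₂ (⋁-hit tail (λ k → w (Fin.suc k)) (k , e))

  ⋁-permute : ∀ {n v} (a : Fin (suc n) → 3^ X) →
              (∀ k → Within v (a k x)) → ∃ (λ k → a k x ≡ v) →
              (σ : Permutation′ (suc n)) → ⋁ (λ i → a (σ ⟨$⟩ʳ i)) x ≡ ⋁ a x
  ⋁-permute {v = v} a w (k , e) σ = begin
    ⋁ (λ i → a (σ ⟨$⟩ʳ i)) x  ≡⟨ ⋁-hit _ (λ i → w (σ ⟨$⟩ʳ i)) (σ ⟨$⟩ˡ k , e′) ⟩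
    v                          ≡⟨ sym (⋁-hit a w (k , e)) ⟩
    ⋁ a x                      ∎
    where e′ : a (σ ⟨$⟩ʳ (σ ⟨$⟩ˡ k)) x ≡ v
          e′ = subst (λ j → a j x ≡ v) (sym (inverseʳ σ)) e

  ⋁-head : ∀ {n} (a : Fin (suc n) → 3^ X) → a zero x ≢ F → ⋁ a x ≡ a zero x
  ⋁-head {ℕ.zero} a _ = refl
  ⋁-head {ℕ.suc n} a ≢F with a zero x
  ... | T = refl
  ... | F = ⊥-elim (≢F refl)
  ... | U = refl

-- The set condition of the proposition: A_i ∩ (A_j ∪ B_j)ᶜ = ∅ for all i, j,
-- i.e. no point is sent to T by one α_i and to U by another α_j.
NoTU : ∀ {ℓ} {X : Set ℓ} {n} → (Fin (suc n) → 3^ X) → Set ℓ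
NoTU α = ∀ i j → Empty (Tset (α i) ∩ ∁ (Tset (α j) ∪ Fset (α j)))

module _ {ℓ : Level} {X : Set ℓ} {n : ℕ} (α : Fin (suc n) → 3^ X) where

  -- If ⊕ α exists, every non-F value of a term equals the join: bring that
  -- term to the front with a transposition and apply ⋁-head.
  ⊕-non-F : ⊕-exists α → ∀ i x → α i x ≢ F → α i x ≡ ⋁ α x
  ⊕-non-F ex i x ≢F = begin
    α i x                                  ≡⟨ sym (⋁-head x (λ k → α (transpose zero i ⟨$⟩ʳ k)) ≢F) ⟩
    ⋁ (λ k → α (transpose zero i ⟨$⟩ʳ k)) x ≡⟨ ex (transpose zero i) x ⟩
    ⋁ α x                                  ∎

  -- (⇒) T and U cannot both be non-F values equal to the same join.
  ⊕-exists⇒NoTU : ⊕-exists α → NoTU α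
  ⊕-exists⇒NoTU ex i j x (αi≡T , ¬TF) with α j x in αj
  ... | T = ¬TF (inj₁ refl)
  ... | F = ¬TF (inj₂ refl)
  ... | U = T≢U (begin
    T      ≡⟨ sym αi≡T ⟩
    α i x  ≡⟨ ⊕-non-F ex i x (λ αi≡F → T≢F (trans (sym αi≡T) αi≡F)) ⟩
    ⋁ α x  ≡⟨ sym (⊕-non-F ex j x (λ αj≡F → U≢F (trans (sym αj) αj≡F))) ⟩
    α j x  ≡⟨ αj ⟩
    U      ∎)

  dominant : NoTU α → (x : X) →
             ∃ λ v → (∀ k → Within v (α k x)) × ∃ (λ k → α k x ≡ v)
  dominant noTU x with any? (λ k → α k x ≟₃ T)
  ... | yes (i , αi≡T) = T , withinT , (i , αi≡T)
    where withinT : ∀ k → Within T (α k x)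
          withinT k with α k x in αk
          ... | T = inj₂ refl
          ... | F = inj₁ refl
          ... | U = ⊥-elim (noTU i k x (αi≡T , λ { (inj₁ t) → T≢U (trans (sym t) αk)
                                                 ; (inj₂ f) → U≢F (trans (sym αk) f) }))
  ... | no noT with any? (λ k → α k x ≟₃ U)
  ...   | yes (i , αi≡U) = U , withinU , (i , αi≡U)
    where withinU : ∀ k → Within U (α k x)
          withinU k with α k x in αk
          ... | T = ⊥-elim (noT (k , αk))
          ... | F = inj₁ refl
          ... | U = inj₂ refl
  ...   | no noU = F , (λ k → inj₁ (allF k)) , (zero , allF zero)
    where allF : ∀ k → α k x ≡ F
          allF k with α k x in αk
          ... | T = ⊥-elim (noT (k , αk))
          ... | F = refl
          ... | U = ⊥-elim (noU (k , αk))

  NoTU⇒⊕-exists : NoTU α → ⊕-exists α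
  NoTU⇒⊕-exists noTU σ x with dominant noTU x
  ... | _ , within , attained = ⋁-permute x α within attained σ

proposition2p51 : {ℓ m : Level} (X : Set ℓ) (M : Pred (3^ X) m) → IsSubalgebra M →
    (n : ℕ) (α : Fin (suc n) → 3^ X) → (∀ i → M (α i)) →
    (⊕-exists α → ∀ i j → Empty (Tset (α i) ∩ ∁ (Tset (α j) ∪ Fset (α j))))
    × ((∀ i j → Empty (Tset (α i) ∩ ∁ (Tset (α j) ∪ Fset (α j)))) → ⊕-exists α)
proposition2p51 X M _ n α _ = ⊕-exists⇒NoTU α , NoTU⇒⊕-exists α
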